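{- Let $G$ be a cube-free median graph, let $T$ be a tree with gated branches in $G$, and let $w\in V(T)$. Then the set of vertices $z$ of $G$ such that $w$ is an imprint of $z$ in $T$ is convex in $G$.
   Context: $d$ is the shortest-path distance in $G$ and $I[a,b]=\{z: d(a,b)=d(a,z)+d(z,b)\}$. A median graph is a connected graph in which $I[a,b]\cap I[b,c]\cap I[c,a]$ is a single vertex for all $a,b,c$; cube-free means no induced 3-cube. A vertex set $X$ is convex if $I[a,b]\subseteq X$ for all $a,b\in X$. A tree with gated branches is a rooted tree $T$ which is a subgraph of $G$ such that every root-to-leaf path of $T$ has a convex vertex set in $G$. For $v\in V(G)$, a vertex $w\in V(T)$ is an imprint of $v$ in $T$ if $I[v,w]\cap V(T)=\{w\}$ (a vertex may have more than one imprint). -}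

module Defs where

open import Data.Nat using (ℕ; zero; suc; _+_; _≤_)
open import Data.Fin using (Fin)
open import Data.Bool using (Bool)
open import Data.Sum using (_⊎_)
open import Data.Product using (Σ; ∃; _×_; _,_)
open import Relation.Nullary using (¬_)
open import Relation.Binary.PropositionalEquality using (_≡_; _≢_)
open import Function.Bundles using (_⇔_)

record Graph : Set₁ where
  field
    n     : ℕ
    Adj   : Fin n → Fin n → Set
    sym   : ∀ {u v} → Adj u v → Adj v u
    irrefl : ∀ {u} → ¬ Adj u u

module _ (G : Graph) where
  open Graph G

  V : Set
  V = Fin n

  data Walk : V → V → ℕ → Set where
    [] : ∀ {u} → Walk u u 0
    _∷_ : ∀ {u v w k} → Adj u v → Walk v w k → Walk u w (suc k)

  Connected : Set
  Connected = ∀ u v → ∃ λ k → Walk u v k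

  IsDist : V → V → ℕ → Set
  IsDist u v k = Walk u v k × (∀ m → Walk u v m → k ≤ m)

  InInterval : V → V → V → Set
  InInterval a b z =
    Σ ℕ λ k₁ → Σ ℕ λ k₂ → IsDist a z k₁ × IsDist z b k₂ × IsDist a b (k₁ + k₂)

  IsMedian : Set
  IsMedian = Connected ×
    (∀ a b c → Σ V λ m →
        (InInterval a b m × InInterval b c m × InInterval c a m) ×
        (∀ z → InInterval a b z → InInterval b c z → InInterval c a z → z ≡ m))

  Q3 : Set
  Q3 = Bool × Bool × Bool

  Q3Adj : Q3 → Q3 → Set
  Q3Adj (a , b , c) (a' , b' , c') =
      (a ≢ a' × b ≡ b' × c ≡ c')
    ⊎ (a ≡ a' × b ≢ b' × c ≡ c')
    ⊎ (a ≡ a' × b ≡ b' × c ≢ c')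

  CubeFree : Set
  CubeFree = ¬ (Σ (Q3 → V) λ f →
                  (∀ x y → f x ≡ f y → x ≡ y) ×
                  (∀ x y → Adj (f x) (f y) ⇔ Q3Adj x y))

  Convex : (V → Set) → Set
  Convex X = ∀ a b z → X a → X b → InInterval a b z → X z

  -- A rooted tree T that is a subgraph of G, given by its vertex set,
  -- root and parent relation (Par c p : p is the parent of c in T).
  data Reach (root : V) (Par : V → V → Set) : V → Set where
    here : Reach root Par root
    step : ∀ {c p} → Par c p → Reach root Par p → Reach root Par c

  record RootedTree : Set₁ where
    field
      InT     : V → Set
      root    : V
      root∈T  : InT root
      Par     : V → V → Set
      Par-adj : ∀ {c p} → Par c p → Adj c p
      Par-T   : ∀ {c p} → Par c p → InT c × InT p
      root-noParent : ∀ {p} → ¬ Par root p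
      Par-unique : ∀ {c p p'} → Par c p → Par c p' → p ≡ p'
      reach   : ∀ {v} → InT v → Reach root Par v

    data Anc : V → V → Set where
      self : ∀ {v} → Anc v v
      up   : ∀ {a v p} → Par v p → Anc a p → Anc a v

    IsLeaf : V → Set
    IsLeaf ℓ = InT ℓ × (∀ c → ¬ Par c ℓ)

    RootPath : V → V → Set
    RootPath ℓ u = Anc u ℓ

    Imprint : V → V → Set
    Imprint v w = InT w × (∀ z → InInterval v w z → InT z → z ≡ w)

  HasGatedBranches : RootedTree → Set
  HasGatedBranches T = ∀ ℓ → IsLeaf ℓ → Convex (RootPath ℓ)
    where open RootedTree T

{-# OPTIONS --safe #-}
module Submission where

-- If w is an imprint of a, every tree neighbour t of w is farther
-- from a than w: it cannot be closer (it would lie in I[a,w]) and it cannot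
-- be at the same distance since median graphs are bipartite. So w ∈ I[a,t]
-- and w ∈ I[b,t]. In a median graph {x : w ∈ I[x,t]} is convex, because the
-- median of a, b, t is the gate of t in I[a,b]; hence w ∈ I[z,t] for every
-- z ∈ I[a,b], and no tree neighbour of w lies in I[z,w]. Conversely, if some
-- tree vertex y ≠ w lay in I[z,w], then a root-to-leaf branch through w
-- (when w ∉ I[z,root]) or through y (when w ∈ I[z,root], so w ∈ I[y,root])
-- is convex and would contain a neighbour of w in I[z,w].

open import Defs
open import Data.Nat using (ℕ; zero; suc; _+_; _≤_; _<_; _∸_; _≤?_; s≤s)
open import Data.Nat.Properties hiding (_≟_)
open import Data.Fin using (Fin; _≟_) renaming (zero to fzero; suc to fsuc; _<_ to _<ᶠ_)
open import Data.Fin.Properties using (pigeonhole)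
open import Data.Product using (Σ; ∃; _×_; _,_; proj₁; proj₂)
open import Data.Sum using (_⊎_; inj₁; inj₂)
open import Data.Empty using (⊥-elim)
open import Relation.Nullary using (¬_; yes; no)
open import Relation.Binary using (tri<; tri≈; tri>)
open import Relation.Binary.PropositionalEquality

module Distance (G : Graph) (dist : ∀ u v → ∃ (IsDist G u v)) where
  open Graph G using (Adj; irrefl)

  private
    variable
      a b m t u v w x y z : V G
      k l : ℕ

  _++ʷ_ : Walk G u v k → Walk G v w l → Walk G u w (k + l)
  [] ++ʷ q = q
  (e ∷ p) ++ʷ q = e ∷ (p ++ʷ q)

  reverse-onto : Walk G u v k → Walk G u w l → Walk G v w (k + l)
  reverse-onto [] acc = acc
  reverse-onto {l = l} (_∷_ {k = k} e p) acc =
    subst (Walk G _ _) (+-suc k l) (reverse-onto p (Graph.sym G e ∷ acc))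

  reverse : Walk G u v k → Walk G v u k
  reverse {k = k} p = subst (Walk G _ _) (+-identityʳ k) (reverse-onto p [])

  d : V G → V G → ℕ
  d u v = proj₁ (dist u v)

  geodesic : ∀ u v → Walk G u v (d u v)
  geodesic u v = proj₁ (proj₂ (dist u v))

  d-minimal : Walk G u v k → d u v ≤ k
  d-minimal {u} {v} p = proj₂ (proj₂ (dist u v)) _ p

  IsDist⇒≡d : IsDist G u v k → k ≡ d u v
  IsDist⇒≡d {u} {v} (p , minimal) = ≤-antisym (minimal _ (geodesic u v)) (d-minimal p)

  d-triangle : ∀ u v w → d u w ≤ d u v + d v w
  d-triangle u v w = d-minimal (geodesic u v ++ʷ geodesic v w)

  d-sym : ∀ u v → d u v ≡ d v u
  d-sym u v = ≤-antisym (d-minimal (reverse (geodesic v u))) (d-minimal (reverse (geodesic u v)))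

  d≡0⇒≡ : d u v ≡ 0 → u ≡ v
  d≡0⇒≡ {u} {v} eq with d u v | geodesic u v
  d≡0⇒≡ refl | _ | [] = refl

  d-refl : ∀ u → d u u ≡ 0
  d-refl u = n≤0⇒n≡0 (d-minimal {u} {u} [])

  d-adj : Adj u v → d u v ≡ 1
  d-adj {u} {v} e with d u v in eq | d-minimal (e ∷ [])
  ... | zero     | _ = ⊥-elim (irrefl (subst (Adj u) (sym (d≡0⇒≡ eq)) e))
  ... | suc zero | _ = refl
  ... | suc (suc _) | s≤s ()

  Between : V G → V G → V G → Set
  Between a z b = d a b ≡ d a z + d z b

  Between⇒InInterval : Between a z b → InInterval G a b z
  Between⇒InInterval {a} {z} {b} azb =
    d a z , d z b , (geodesic a z , λ _ → d-minimal) , (geodesic z b , λ _ → d-minimal) ,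
    subst (IsDist G a b) azb (geodesic a b , λ _ → d-minimal)

  InInterval⇒Between : InInterval G a b z → Between a z b
  InInterval⇒Between (_ , _ , az , zb , ab) =
    trans (sym (IsDist⇒≡d ab)) (cong₂ _+_ (IsDist⇒≡d az) (IsDist⇒≡d zb))

  Between-sym : Between a z b → Between b z a
  Between-sym {a} {z} {b} azb = begin
    d b a             ≡⟨ d-sym b a ⟩
    d a b             ≡⟨ azb ⟩
    d a z + d z b     ≡⟨ +-comm (d a z) (d z b) ⟩
    d z b + d a z     ≡⟨ cong₂ _+_ (d-sym z b) (d-sym a z) ⟩
    d b z + d z a     ∎
    where open ≡-Reasoning

  Between-self : ∀ a b → Between a b b
  Between-self a b = sym (trans (cong (d a b +_) (d-refl b)) (+-identityʳ (d a b)))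

  Between-⊆ˡ : Between a u b → Between a v u → Between a v b
  Between-⊆ˡ {a} {u} {b} {v} aub avu = ≤-antisym (d-triangle a v b) (begin
    d a v + d v b             ≤⟨ +-monoʳ-≤ (d a v) (d-triangle v u b) ⟩
    d a v + (d v u + d u b)   ≡⟨ +-assoc (d a v) _ _ ⟨
    (d a v + d v u) + d u b   ≡⟨ cong (_+ d u b) avu ⟨
    d a u + d u b             ≡⟨ aub ⟨
    d a b                     ∎)
    where open ≤-Reasoning

  Between-shift : Between a u b → Between a v u → Between v u b
  Between-shift {a} {u} {b} {v} aub avu = +-cancelˡ-≡ (d a v) _ _ (begin
    d a v + d v b             ≡⟨ Between-⊆ˡ aub avu ⟨
    d a b                     ≡⟨ aub ⟩
    d a u + d u b             ≡⟨ cong (_+ d u b) avu ⟩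
    (d a v + d v u) + d u b   ≡⟨ +-assoc (d a v) _ _ ⟩
    d a v + (d v u + d u b)   ∎)
    where open ≡-Reasoning

  Between-⊆ʳ : Between a u b → Between u v b → Between a v b
  Between-⊆ʳ aub uvb = Between-sym (Between-⊆ˡ (Between-sym aub) (Between-sym uvb))

  Between-antisym : Between z u v → Between z v u → u ≡ v
  Between-antisym {z} {u} {v} zuv zvu = d≡0⇒≡ (m+n≡0⇒n≡0 (d v u) (+-cancelˡ-≡ (d z v) _ _ (begin
    d z v + (d v u + d u v)   ≡⟨ +-assoc (d z v) _ _ ⟨
    (d z v + d v u) + d u v   ≡⟨ cong (_+ d u v) zvu ⟨
    d z u + d u v             ≡⟨ zuv ⟨
    d z v                     ≡⟨ +-identityʳ (d z v) ⟨
    d z v + 0                 ∎)))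
    where open ≡-Reasoning

  d-via-adj : Adj u v → d x u + d u v ≡ suc (d x u)
  d-via-adj {u = u} {x = x} e = trans (cong (d x u +_) (d-adj e)) (+-comm (d x u) 1)

  Between⇒d-suc : Adj u v → Between x u v → d x v ≡ suc (d x u)
  Between⇒d-suc e xuv = trans xuv (d-via-adj e)

  d-suc⇒Between : Adj u v → d x v ≡ suc (d x u) → Between x u v
  d-suc⇒Between e eq = trans eq (sym (d-via-adj e))

  Between-adjacent : Adj u v → Between u m v → m ≡ u ⊎ m ≡ v
  Between-adjacent {u} {v} {m} e umv with d u m in eq
  ... | zero  = inj₁ (sym (d≡0⇒≡ eq))
  ... | suc k = inj₂ (d≡0⇒≡ (m+n≡0⇒n≡0 k (sym (suc-injective (trans (sym (d-adj e)) umv)))))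

  geodesic-first-step : u ≢ v → Σ (V G) λ x → Adj u x × Between u x v
  geodesic-first-step {u} {v} u≢v with d u v in eq | geodesic u v
  ... | zero  | [] = ⊥-elim (u≢v refl)
  ... | suc k | _∷_ {v = x} e p =
    x , e , ≤-antisym (subst (_≤ d u x + d x v) eq (d-triangle u x v)) (begin
    d u x + d x v   ≡⟨ cong (_+ d x v) (d-adj e) ⟩
    suc (d x v)     ≤⟨ s≤s (d-minimal p) ⟩
    suc k           ∎)
    where open ≤-Reasoning

  convex-step-toward : ∀ {C : V G → Set} → Convex G C → C x → C y →
    Between x m y → Between z m x → m ≢ x →
    Σ (V G) λ x′ → C x′ × Adj x x′ × Between z x′ x
  convex-step-toward {x} {y} {m} {z} convex Cx Cy xmy zmx m≢x
    with geodesic-first-step (λ x≡m → m≢x (sym x≡m))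
  ... | x′ , e , xx′m =
    x′ , convex x y x′ Cx Cy (Between⇒InInterval (Between-⊆ˡ xmy xx′m)) , e ,
    Between-sym (Between-⊆ˡ (Between-sym zmx) xx′m)

module Median (G : Graph) (med : IsMedian G) where
  open Graph G using (Adj)

  private
    variable
      a b m t w x z : V G

  -- IsMedian only yields distances through intervals: the median of u, v, v
  -- witnesses d(u,v).
  distance : ∀ u v → ∃ (IsDist G u v)
  distance u v with proj₂ med u v v
  ... | _ , ((k₁ , k₂ , _ , _ , uv) , _) , _ = k₁ + k₂ , uv

  open Distance G distance public

  IsMedianOf : V G → V G → V G → V G → Set
  IsMedianOf a b c m = Between a m b × Between b m c × Between c m a

  median : ∀ a b c → ∃ (IsMedianOf a b c)
  median a b c with proj₂ med a b c
  ... | m , (ab , bc , ca) , _ =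
    m , InInterval⇒Between ab , InInterval⇒Between bc , InInterval⇒Between ca

  median-unique : ∀ {a b c m m′} → IsMedianOf a b c m → IsMedianOf a b c m′ → m ≡ m′
  median-unique {a} {b} {c} (ab , bc , ca) (ab′ , bc′ , ca′) with proj₂ med a b c
  ... | _ , _ , unique = trans (only ab bc ca) (sym (only ab′ bc′ ca′))
    where
    only = λ {m} ab bc ca →
      unique m (Between⇒InInterval ab) (Between⇒InInterval bc) (Between⇒InInterval ca)

  -- With y = median(a,z,x), the median n of y, b, x is a median of a, b, x,
  -- and it lies on a geodesic z — y — n — x.
  median-gate : IsMedianOf a b x m → Between a z b → Between z m x
  median-gate {a} {b} {x} {m} {z} amb-bmx-xma azb with median a z x
  ... | y , ayz , zyx , xya with median y b x
  ... | n , ynb , bnx , xny =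
    subst (λ q → Between z q x) (median-unique n-median amb-bmx-xma)
      (Between-⊆ʳ zyx (Between-sym xny))
    where
    n-median : IsMedianOf a b x n
    n-median = Between-⊆ʳ (Between-⊆ˡ azb ayz) ynb , bnx , Between-⊆ˡ xya xny

  adjacent-d-≢ : ∀ z → Adj w t → d z w ≢ d z t
  adjacent-d-≢ {w} {t} z e eq with median z w t
  ... | m , zmw , wmt , tmz with Between-adjacent e wmt
  ... | inj₁ m≡w = 1+n≢n (trans (sym (Between⇒d-suc e zwt)) (sym eq))
    where zwt = Between-sym (subst (λ q → Between t q z) m≡w tmz)
  ... | inj₂ m≡t = 1+n≢n (trans (sym (Between⇒d-suc (Graph.sym G e) ztw)) eq)
    where ztw = subst (λ q → Between z q w) m≡t zmw

  Between-convex : Between a w t → Between b w t → Between a z b → Between z w t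
  Between-convex {a} {w} {t} {b} {z} awt bwt azb with median a b w
  ... | m , amb , bmw , wma = begin
    d z t                   ≡⟨ median-gate (amb , Between-⊆ˡ bwt bmw , Between-sym amt) azb ⟩
    d z m + d m t           ≡⟨ cong (d z m +_) (Between-shift awt amw) ⟩
    d z m + (d m w + d w t) ≡⟨ +-assoc (d z m) _ _ ⟨
    (d z m + d m w) + d w t ≡⟨ cong (_+ d w t) (median-gate (amb , bmw , wma) azb) ⟨
    d z w + d w t           ∎
    where
    open ≡-Reasoning
    amw = Between-sym wma
    amt = Between-⊆ˡ awt amw

module TreeStructure (G : Graph) (T : RootedTree G) where
  open Graph G using (n; irrefl)
  open RootedTree T

  private
    variable
      a b c p u v : V G

  Reach⇒InT : Reach G root Par v → InT v
  Reach⇒InT here = root∈T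
  Reach⇒InT (step pc _) = proj₁ (Par-T pc)

  Anc⇒InT : InT v → Anc a v → InT a
  Anc⇒InT vT self = vT
  Anc⇒InT vT (up pc ap) = Anc⇒InT (proj₂ (Par-T pc)) ap

  Reach⇒Anc-root : Reach G root Par v → Anc root v
  Reach⇒Anc-root here = self
  Reach⇒Anc-root (step pc r) = up pc (Reach⇒Anc-root r)

  Anc-root : InT v → Anc root v
  Anc-root vT = Reach⇒Anc-root (reach vT)

  Anc-trans : Anc a b → Anc b c → Anc a c
  Anc-trans ab self = ab
  Anc-trans ab (up pc bp) = up pc (Anc-trans ab bp)

  Par-acyclic : Reach G root Par p → Par v p → ¬ Anc v p
  Par-acyclic here pv-root self = root-noParent pv-root
  Par-acyclic here _ (up p-root _) = root-noParent p-root
  Par-acyclic (step _ _) pvp self = irrefl (Par-adj pvp)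
  Par-acyclic (step ppq rq) pvp (up ppq′ avq′) =
    Par-acyclic rq ppq (Anc-trans (up pvp self) (subst (Anc _) (Par-unique ppq′ ppq) avq′))

  depth : Reach G root Par v → ℕ
  depth here = 0
  depth (step _ r) = suc (depth r)

  ancestor : (r : Reach G root Par v) → Fin (suc (depth r)) → V G
  ancestor here _ = root
  ancestor (step {c = c} _ _) fzero = c
  ancestor (step _ r) (fsuc i) = ancestor r i

  ancestor-Anc : (r : Reach G root Par v) (i : Fin (suc (depth r))) → Anc (ancestor r i) v
  ancestor-Anc here fzero = self
  ancestor-Anc (step _ _) fzero = self
  ancestor-Anc (step pc r) (fsuc i) = up pc (ancestor-Anc r i)

  ProperAnc : V G → V G → Set
  ProperAnc a v = Σ (V G) λ p → Par v p × Anc a p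

  ancestor-ProperAnc : (r : Reach G root Par v) (i j : Fin (suc (depth r))) →
    i <ᶠ j → ProperAnc (ancestor r j) (ancestor r i)
  ancestor-ProperAnc (step {p = p} pc r) fzero (fsuc j) _ = p , pc , ancestor-Anc r j
  ancestor-ProperAnc (step pc r) (fsuc i) (fsuc j) (s≤s i<j) = ancestor-ProperAnc r i j i<j

  depth<n : (r : Reach G root Par v) → depth r < n
  depth<n r with suc (depth r) ≤? n
  ... | yes depth<n = depth<n
  ... | no depth≮n with pigeonhole (≰⇒> depth≮n) (ancestor r)
  ... | i , j , i<j , same with ancestor-ProperAnc r i j i<j
  ... | p , pxp , ajp = ⊥-elim
    (Par-acyclic (reach (proj₂ (Par-T pxp))) pxp (subst (λ q → Anc q p) (sym same) ajp))

  private
    descend : ∀ k (r : Reach G root Par v) → depth r + k ≡ n → Anc u v →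
              ¬ (∀ ℓ → IsLeaf ℓ → ¬ Anc u ℓ)
    descend {v} k r depth+k≡n uv noLeaf = noLeaf v (Reach⇒InT r , childless k depth+k≡n) uv
      where
      childless : ∀ k → depth r + k ≡ n → ∀ c → ¬ Par c v
      childless zero eq _ _ = <-irrefl (trans (sym (+-identityʳ _)) eq) (depth<n r)
      childless (suc k) eq c pc =
        descend k (step pc r) (trans (sym (+-suc _ k)) eq) (up pc uv) noLeaf

  -- Par is an arbitrary relation, not a decidable one, so the leaf cannot be
  -- computed; only its double negation is available.
  leaf-below : InT u → ¬ (∀ ℓ → IsLeaf ℓ → ¬ Anc u ℓ)
  leaf-below {u} uT = descend (n ∸ depth r) r (m+[n∸m]≡n (<⇒≤ (depth<n r))) self
    where r = reach uT

module ImprintRegion (G : Graph) (med : IsMedian G) (T : RootedTree G) where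
  open Graph G using (Adj; irrefl)
  open Median G med
  open TreeStructure G T
  open RootedTree T

  private
    variable
      a m t w x y z ℓ : V G

  NoTreeNeighbourToward : V G → V G → Set
  NoTreeNeighbourToward z w = ∀ t → InT t → Adj w t → ¬ Between z t w

  branch-neighbour-toward : HasGatedBranches G T → IsLeaf ℓ → Anc w ℓ → Anc x ℓ →
    Between w m x → Between z m w → m ≢ w → ¬ NoTreeNeighbourToward z w
  branch-neighbour-toward gated leaf wℓ xℓ wmx zmw m≢w none
    with convex-step-toward (gated _ leaf) wℓ xℓ wmx zmw m≢w
  ... | t , tℓ , e , ztw = none t (Anc⇒InT (proj₁ leaf) tℓ) e ztw

  tree-neighbour-toward : HasGatedBranches G T → InT w → InT y → Between z y w → y ≢ w →
    ¬ NoTreeNeighbourToward z w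
  tree-neighbour-toward {w} {y} {z} gated wT yT zyw y≢w none with median z w root
  ... | m , zmw , wmr , rmz with m ≟ w
  ... | no m≢w = leaf-below wT λ ℓ leaf wℓ →
    branch-neighbour-toward gated leaf wℓ (Anc-root (proj₁ leaf)) wmr zmw m≢w none
  ... | yes m≡w = leaf-below yT λ ℓ leaf yℓ →
    branch-neighbour-toward gated leaf
      (gated ℓ leaf y root w yℓ (Anc-root (proj₁ leaf)) (Between⇒InInterval ywr))
      yℓ (Between-self w y) zyw y≢w none
    where
    ywr : Between y w root
    ywr = Between-shift (Between-sym (subst (λ q → Between root q z) m≡w rmz)) zyw

  imprint-Between : Imprint a w → Adj w t → InT t → Between a w t
  imprint-Between {a} {w} {t} (_ , imprint) e tT with <-cmp (d a t) (d a w)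
  ... | tri< t-closer _ _ = ⊥-elim (irrefl (subst (Adj w) (imprint t (Between⇒InInterval atw) tT) e))
    where
    atw : Between a t w
    atw = d-suc⇒Between (Graph.sym G e)
      (≤-antisym (subst (d a w ≤_) (d-via-adj (Graph.sym G e)) (d-triangle a t w)) t-closer)
  ... | tri≈ _ same _ = ⊥-elim (adjacent-d-≢ a e (sym same))
  ... | tri> _ _ t-farther = d-suc⇒Between e
    (≤-antisym (subst (d a t ≤_) (d-via-adj e) (d-triangle a w t)) t-farther)

lemma8 : (G : Graph) → IsMedian G → CubeFree G →
    (T : RootedTree G) → HasGatedBranches G T →
    (w : V G) → RootedTree.InT T w →
    Convex G (λ z → RootedTree.Imprint T z w)
lemma8 G med _ T gated w wT a b z aw bw azb = wT , only-w
  where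
  open Median G med
  open ImprintRegion G med T
  open RootedTree T

  no-tree-neighbour : NoTreeNeighbourToward z w
  no-tree-neighbour t tT e ztw = Graph.irrefl G (subst (Graph.Adj G w) (Between-antisym ztw zwt) e)
    where
    zwt : Between z w t
    zwt = Between-convex (imprint-Between aw e tT) (imprint-Between bw e tT) (InInterval⇒Between azb)

  only-w : ∀ y → InInterval G z w y → InT y → y ≡ w
  only-w y zyw yT with y ≟ w
  ... | yes y≡w = y≡w
  ... | no y≢w = ⊥-elim (tree-neighbour-toward gated wT yT (InInterval⇒Between zyw) y≢w no-tree-neighbour)
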